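{- Let $v\geq0$ be an integer, let $t^{(v)}(m,j)$ and $T^{(v)}(n,j)$ be the Stirling type numbers of the first and second kind associated with the sequence $a_n=n(n+v)$, define polynomials $F_n^{(v)}(z)$ for $n\geq1$ by $zF_n^{(v)}(z)=\sum_{j=0}^n(-1)^{n+j}T^{(v)}(n,j)\,j!\,(z)^j$, and set $g_n^{(v)}:=F_n^{(v)}(v)$. Then for all integers $m,v\geq0$ and $n\geq1$, \[ \sum_{j=0}^m(-1)^{m+j}t^{(v)}(m,j)\,g_{n+j}^{(v)}=\frac{m!}{v!}\sum_{j=0}^{n}(-1)^{n+j}T^{(v)}(n,j)\,j!\,(j+m+v-1)!, \] where the term with $j=0$ on the right-hand side is taken to be $0$ (since $T^{(v)}(n,0)=0$ for $n\geq1$).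
   Context: $(z)^0=1$ and $(z)^n=z(z+1)\cdots(z+n-1)$ for $n\geq1$. Stirling type numbers for a sequence $(a_n)_{n\geq1}$: $t(n+1,j)=t(n,j-1)-a_nt(n,j)$ and $T(n+1,j)=T(n,j-1)+a_jT(n,j)$, with $t(n,0)=T(n,0)=\delta_{n,0}$ and $t(n,j)=T(n,j)=0$ for $n<j$. -}

module Defs where

open import Data.Nat using (ℕ; zero; suc; _∸_; _!) renaming (_+_ to _+ℕ_; _*_ to _*ℕ_)

open import Data.Integer using (ℤ; +_; _+_; _-_; _*_; -_)

a : ℕ → ℕ → ℕ
a v n = n *ℕ (n +ℕ v)

sgn : ℕ → ℤ
sgn zero    = + 1
sgn (suc k) = - sgn k

-- rising factorial (z)^n = z (z+1) ... (z+n-1)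
rising : ℤ → ℕ → ℤ
rising z zero    = + 1
rising z (suc n) = rising z n * (z + + n)

sumTo : ℕ → (ℕ → ℤ) → ℤ
sumTo zero    f = f 0
sumTo (suc n) f = sumTo n f + f (suc n)

sum1 : ℕ → (ℕ → ℤ) → ℤ
sum1 zero    f = + 0
sum1 (suc n) f = sum1 n f + f (suc n)

st1 : ℕ → ℕ → ℕ → ℤ
st1 v zero    zero    = + 1
st1 v zero    (suc j) = + 0
st1 v (suc n) zero    = + 0
st1 v (suc n) (suc j) = st1 v n j - (+ a v n) * st1 v n (suc j)

St2 : ℕ → ℕ → ℕ → ℕ
St2 v zero    zero    = 1
St2 v zero    (suc j) = 0
St2 v (suc n) zero    = 0
St2 v (suc n) (suc j) = St2 v n j +ℕ a v (suc j) *ℕ St2 v n (suc j)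

-- P_n(z) = Σ_{j=0}^n (-1)^{n+j} T(n,j) j! (z)^j   (the right side of z F_n(z) = ...)
P : ℕ → ℕ → ℤ → ℤ
P v n z = sumTo n (λ j → sgn (n +ℕ j) * (+ St2 v n j) * (+ (j !)) * rising z j)

-- F_n(z) for n ≥ 1: since T(n,0) = 0 for n ≥ 1 and (z)^j = z (z+1)^{j-1} for j ≥ 1,
-- the polynomial quotient P_n(z)/z is
-- F_n(z) = Σ_{j=1}^n (-1)^{n+j} T(n,j) j! (z+1)^{j-1}.
F : ℕ → ℕ → ℤ → ℤ
F v n z = sum1 n (λ j → sgn (n +ℕ j) * (+ St2 v n j) * (+ (j !)) * rising (z + + 1) (j ∸ 1))

g : ℕ → ℕ → ℤ
g v n = F v n (+ v)

{-# OPTIONS --safe #-}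
module Submission where

open import Defs
open import Data.Nat using (ℕ; zero; suc; _≤_; _<_; s≤s; z≤n; _∸_; _!; NonZero) renaming (_+_ to _+ℕ_; _*_ to _*ℕ_)
import Data.Nat.Properties as ℕP
import Data.Nat.Tactic.RingSolver as ℕRing
open import Data.Integer using (ℤ; +_; _*_; _+_; _-_; -_)
import Data.Integer.Properties as ℤP
open import Data.Integer.Tactic.RingSolver using (solve-∀)
open import Algebra.Properties.CommutativeSemigroup ℤP.+-commutativeSemigroup using (interchange)
open import Algebra.Properties.CommutativeSemigroup ℤP.*-commutativeSemigroup using (x∙yz≈y∙xz)
open import Relation.Binary.PropositionalEquality
open ≡-Reasoning

-- Both sides, viewed as functions X(m, n), satisfy
--   X(m+1, n) = X(m, n+1) + a_m X(m, n),
-- so they agree once they agree at m = 0. On the left this is the recurrence of t.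
-- On the right it follows from the recurrence of T and the identity
--   (m+1)! (k+m+v)! = (k+1) m! (k+m+v)! + (a_m − a_k) m! (k+m+v−1)!,
-- which holds because a_m − a_k = (m − k)(k + m + v). At m = 0 both sides agree
-- because v! (v+1)^{(j−1)} = (j+v−1)!.

sumTo-cong : ∀ n {f h : ℕ → ℤ} → (∀ j → f j ≡ h j) → sumTo n f ≡ sumTo n h
sumTo-cong zero    f≡h = f≡h 0
sumTo-cong (suc n) f≡h = cong₂ _+_ (sumTo-cong n f≡h) (f≡h (suc n))

sumTo-+ : ∀ n (f h : ℕ → ℤ) → sumTo n (λ j → f j + h j) ≡ sumTo n f + sumTo n h
sumTo-+ zero    f h = refl
sumTo-+ (suc n) f h =
  trans (cong (_+ (f (suc n) + h (suc n))) (sumTo-+ n f h))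
        (interchange (sumTo n f) (sumTo n h) (f (suc n)) (h (suc n)))

sumTo-- : ∀ n (f h : ℕ → ℤ) → sumTo n (λ j → f j - h j) ≡ sumTo n f - sumTo n h
sumTo-- zero    f h = refl
sumTo-- (suc n) f h = begin
    sumTo n (λ j → f j - h j) + (f (suc n) - h (suc n))
  ≡⟨ cong (_+ (f (suc n) - h (suc n))) (sumTo-- n f h) ⟩
    (sumTo n f - sumTo n h) + (f (suc n) - h (suc n))
  ≡⟨ interchange (sumTo n f) (- sumTo n h) (f (suc n)) (- h (suc n)) ⟩
    (sumTo n f + f (suc n)) + (- sumTo n h + - h (suc n))
  ≡⟨ cong (_+_ (sumTo n f + f (suc n))) (sym (ℤP.neg-distrib-+ (sumTo n h) (h (suc n)))) ⟩
    (sumTo n f + f (suc n)) - (sumTo n h + h (suc n))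
  ∎

sumTo-* : ∀ n (c : ℤ) (f : ℕ → ℤ) → sumTo n (λ j → c * f j) ≡ c * sumTo n f
sumTo-* zero    c f = refl
sumTo-* (suc n) c f =
  trans (cong (_+ c * f (suc n)) (sumTo-* n c f)) (sym (ℤP.*-distribˡ-+ c _ _))

sumTo-suc-head : ∀ n (f : ℕ → ℤ) → f 0 ≡ + 0 → sumTo (suc n) f ≡ sumTo n (λ j → f (suc j))
sumTo-suc-head zero    f f0≡0 = trans (cong (_+ f 1) f0≡0) (ℤP.+-identityˡ (f 1))
sumTo-suc-head (suc n) f f0≡0 = cong (_+ f (suc (suc n))) (sumTo-suc-head n f f0≡0)

sumTo-shift : ∀ n (f : ℕ → ℤ) → f 0 ≡ + 0 → f (suc n) ≡ + 0 →
              sumTo n (λ j → f (suc j)) ≡ sumTo n f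
sumTo-shift n f f0≡0 fn≡0 = begin
    sumTo n (λ j → f (suc j))  ≡⟨ sumTo-suc-head n f f0≡0 ⟨
    sumTo n f + f (suc n)      ≡⟨ cong (_+_ (sumTo n f)) fn≡0 ⟩
    sumTo n f + + 0            ≡⟨ ℤP.+-identityʳ _ ⟩
    sumTo n f                  ∎

sum1≡sumTo : ∀ n (f : ℕ → ℤ) → f 0 ≡ + 0 → sum1 n f ≡ sumTo n f
sum1≡sumTo zero    f f0≡0 = sym f0≡0
sum1≡sumTo (suc n) f f0≡0 = cong (_+ f (suc n)) (sum1≡sumTo n f f0≡0)

sgn-+-suc : ∀ m j → sgn (m +ℕ suc j) ≡ - sgn (m +ℕ j)
sgn-+-suc m j = cong sgn (ℕP.+-suc m j)

pos-+-* : ∀ x y z → + (x +ℕ y *ℕ z) ≡ + x + + y * + z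
pos-+-* x y z = trans (ℤP.pos-+ x (y *ℕ z)) (cong (_+_ (+ x)) (ℤP.pos-* y z))

!-pred : ∀ n → .{{NonZero n}} → n ! ≡ n *ℕ (n ∸ 1) !
!-pred (suc n) = refl

Recurrence : (ℕ → ℤ) → (ℕ → ℕ → ℤ) → Set
Recurrence b X = ∀ m n → X (suc m) n ≡ X m (suc n) + b m * X m n

recurrence-scale : ∀ b X (c : ℤ) → Recurrence b X → Recurrence b (λ m n → c * X m n)
recurrence-scale b X c rec m n = begin
    c * X (suc m) n                  ≡⟨ cong (c *_) (rec m n) ⟩
    c * (X m (suc n) + b m * X m n)  ≡⟨ distrib c (X m (suc n)) (b m) (X m n) ⟩
    c * X m (suc n) + b m * (c * X m n) ∎
  where
  distrib : ∀ c x b y → c * (x + b * y) ≡ c * x + b * (c * y)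
  distrib = solve-∀

recurrence-unique : ∀ b X Y → Recurrence b X → Recurrence b Y →
                    (∀ n → X 0 (suc n) ≡ Y 0 (suc n)) →
                    ∀ m n → 1 ≤ n → X m n ≡ Y m n
recurrence-unique b X Y recX recY X≡Y₀ zero    (suc n) _   = X≡Y₀ n
recurrence-unique b X Y recX recY X≡Y₀ (suc m) n 1≤n = begin
    X (suc m) n                   ≡⟨ recX m n ⟩
    X m (suc n) + b m * X m n     ≡⟨ cong₂ (λ x y → x + b m * y) (IH (suc n) (s≤s z≤n)) (IH n 1≤n) ⟩
    Y m (suc n) + b m * Y m n     ≡⟨ recY m n ⟨
    Y (suc m) n                   ∎
  where
  IH : ∀ n → 1 ≤ n → X m n ≡ Y m n
  IH = recurrence-unique b X Y recX recY X≡Y₀ m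

module _ (v : ℕ) where

  st1-above : ∀ {m j} → m < j → st1 v m j ≡ + 0
  st1-above {zero}  {suc j} _ = refl
  st1-above {suc m} {suc j} (s≤s m<j)
    rewrite st1-above m<j | st1-above (ℕP.m<n⇒m<1+n m<j) = cong (_-_ (+ 0)) (ℤP.*-zeroʳ (+ a v m))

  St2-above : ∀ {n k} → n < k → St2 v n k ≡ 0
  St2-above {zero}  {suc k} _ = refl
  St2-above {suc n} {suc k} (s≤s n<k)
    rewrite St2-above n<k | St2-above (ℕP.m<n⇒m<1+n n<k) = ℕP.*-zeroʳ (a v (suc k))

  signedSt1 : ℕ → ℕ → ℤ
  signedSt1 m j = sgn (m +ℕ j) * st1 v m j

  signedSt1-suc-zero : ∀ m → signedSt1 (suc m) 0 ≡ + 0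
  signedSt1-suc-zero m = ℤP.*-zeroʳ (sgn (suc m +ℕ 0))

  a*signedSt1-zero : ∀ m → + a v m * signedSt1 m 0 ≡ + 0
  a*signedSt1-zero zero    = refl
  a*signedSt1-zero (suc m) = trans (cong (+ a v (suc m) *_) (signedSt1-suc-zero m)) (ℤP.*-zeroʳ (+ a v (suc m)))

  signedSt1-above : ∀ {m j} → m < j → signedSt1 m j ≡ + 0
  signedSt1-above {m} {j} m<j = trans (cong (sgn (m +ℕ j) *_) (st1-above m<j)) (ℤP.*-zeroʳ (sgn (m +ℕ j)))

  signedSt1-suc : ∀ m j → signedSt1 (suc m) (suc j) ≡ signedSt1 m j + + a v m * signedSt1 m (suc j)
  signedSt1-suc m j rewrite sgn-+-suc m j = ring (sgn (m +ℕ j)) (st1 v m j) (st1 v m (suc j)) (+ a v m)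
    where
    ring : ∀ s t t′ c → - (- s) * (t - c * t′) ≡ s * t + c * (- s * t′)
    ring = solve-∀

  tTransform : (ℕ → ℤ) → ℕ → ℕ → ℤ
  tTransform f m n = sumTo m (λ j → signedSt1 m j * f (n +ℕ j))

  tTransform-recurrence : ∀ f → Recurrence (λ m → + a v m) (tTransform f)
  tTransform-recurrence f m n = begin
      tTransform f (suc m) n
    ≡⟨ sumTo-suc-head m (λ j → signedSt1 (suc m) j * f (n +ℕ j)) first-zero ⟩
      sumTo m (λ j → signedSt1 (suc m) (suc j) * f (n +ℕ suc j))
    ≡⟨ sumTo-cong m expand ⟩
      sumTo m (λ j → signedSt1 m j * f (suc n +ℕ j) + + a v m * h (suc j))
    ≡⟨ sumTo-+ m (λ j → signedSt1 m j * f (suc n +ℕ j)) (λ j → + a v m * h (suc j)) ⟩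
      tTransform f m (suc n) + sumTo m (λ j → + a v m * h (suc j))
    ≡⟨ cong (_+_ (tTransform f m (suc n))) (sumTo-shift m (λ j → + a v m * h j) a*h-zero a*h-top) ⟩
      tTransform f m (suc n) + sumTo m (λ j → + a v m * h j)
    ≡⟨ cong (_+_ (tTransform f m (suc n))) (sumTo-* m (+ a v m) h) ⟩
      tTransform f m (suc n) + + a v m * tTransform f m n
    ∎
    where
    h : ℕ → ℤ
    h j = signedSt1 m j * f (n +ℕ j)

    first-zero : signedSt1 (suc m) 0 * f (n +ℕ 0) ≡ + 0
    first-zero = trans (cong (_* f (n +ℕ 0)) (signedSt1-suc-zero m)) (ℤP.*-zeroˡ (f (n +ℕ 0)))

    expand : ∀ j → signedSt1 (suc m) (suc j) * f (n +ℕ suc j)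
                   ≡ signedSt1 m j * f (suc n +ℕ j) + + a v m * h (suc j)
    expand j = begin
        signedSt1 (suc m) (suc j) * f (n +ℕ suc j)
      ≡⟨ cong (_* f (n +ℕ suc j)) (signedSt1-suc m j) ⟩
        (signedSt1 m j + + a v m * signedSt1 m (suc j)) * f (n +ℕ suc j)
      ≡⟨ ℤP.*-distribʳ-+ (f (n +ℕ suc j)) (signedSt1 m j) (+ a v m * signedSt1 m (suc j)) ⟩
        signedSt1 m j * f (n +ℕ suc j) + + a v m * signedSt1 m (suc j) * f (n +ℕ suc j)
      ≡⟨ cong₂ _+_ (cong (λ i → signedSt1 m j * f i) (ℕP.+-suc n j))
                   (ℤP.*-assoc (+ a v m) (signedSt1 m (suc j)) (f (n +ℕ suc j))) ⟩
        signedSt1 m j * f (suc n +ℕ j) + + a v m * h (suc j)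
      ∎

    a*h-zero : + a v m * h 0 ≡ + 0
    a*h-zero = trans (sym (ℤP.*-assoc (+ a v m) (signedSt1 m 0) (f (n +ℕ 0))))
                 (trans (cong (_* f (n +ℕ 0)) (a*signedSt1-zero m)) (ℤP.*-zeroˡ (f (n +ℕ 0))))

    a*h-top : + a v m * h (suc m) ≡ + 0
    a*h-top = trans (cong (λ t → + a v m * (t * f (n +ℕ suc m))) (signedSt1-above (ℕP.n<1+n m)))
                 (trans (cong (+ a v m *_) (ℤP.*-zeroˡ (f (n +ℕ suc m)))) (ℤP.*-zeroʳ (+ a v m)))

  signedSt2! : ℕ → ℕ → ℤ
  signedSt2! n k = sgn (n +ℕ k) * + St2 v n k * + (k !)

  signedSt2!-suc-zero : ∀ n → signedSt2! (suc n) 0 ≡ + 0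
  signedSt2!-suc-zero n = cong (_* + 1) (ℤP.*-zeroʳ (sgn (suc n +ℕ 0)))

  signedSt2!-above : ∀ {n k} → n < k → signedSt2! n k ≡ + 0
  signedSt2!-above {n} {k} n<k = begin
      sgn (n +ℕ k) * + St2 v n k * + (k !)  ≡⟨ cong (λ t → sgn (n +ℕ k) * + t * + (k !)) (St2-above n<k) ⟩
      sgn (n +ℕ k) * + 0 * + (k !)          ≡⟨ cong (_* + (k !)) (ℤP.*-zeroʳ (sgn (n +ℕ k))) ⟩
      + 0 * + (k !)                         ≡⟨ ℤP.*-zeroˡ (+ (k !)) ⟩
      + 0                                   ∎

  signedSt2!-suc : ∀ n k → signedSt2! (suc n) (suc k)
                           ≡ + suc k * signedSt2! n k - + a v (suc k) * signedSt2! n (suc k)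
  signedSt2!-suc n k = begin
      sgn (suc n +ℕ suc k) * + (St2 v n k +ℕ a v (suc k) *ℕ St2 v n (suc k)) * + (suc k !)
    ≡⟨ cong₂ (λ x y → sgn (suc n +ℕ suc k) * x * y)
             (pos-+-* (St2 v n k) (a v (suc k)) (St2 v n (suc k))) (ℤP.pos-* (suc k) (k !)) ⟩
      - sgn (n +ℕ suc k) * (T + α * T′) * (K * Φ)
    ≡⟨ cong (λ s → - s * (T + α * T′) * (K * Φ)) (sgn-+-suc n k) ⟩
      - (- s) * (T + α * T′) * (K * Φ)
    ≡⟨ ring s T T′ α K Φ ⟩
      K * (s * T * Φ) - α * (- s * T′ * (K * Φ))
    ≡⟨ cong₂ (λ s′ Φ′ → K * (s * T * Φ) - α * (s′ * T′ * Φ′)) (sgn-+-suc n k) (ℤP.pos-* (suc k) (k !)) ⟨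
      + suc k * signedSt2! n k - α * signedSt2! n (suc k)
    ∎
    where
    s T T′ α K Φ : ℤ
    s = sgn (n +ℕ k)
    T = + St2 v n k
    T′ = + St2 v n (suc k)
    α = + a v (suc k)
    K = + suc k
    Φ = + (k !)

    ring : ∀ s T T′ α K Φ → - (- s) * (T + α * T′) * (K * Φ) ≡ K * (s * T * Φ) - α * (- s * T′ * (K * Φ))
    ring = solve-∀

  TTransform : (ℕ → ℕ → ℕ) → ℕ → ℕ → ℤ
  TTransform c m n = sumTo n (λ k → signedSt2! n k * + c m k)

  KernelRecurrence : (ℕ → ℕ → ℕ) → Set
  KernelRecurrence c = ∀ m k → c (suc m) k +ℕ a v k *ℕ c m k ≡ suc k *ℕ c m (suc k) +ℕ a v m *ℕ c m k

  TTransform-recurrence : ∀ c → KernelRecurrence c → Recurrence (λ m → + a v m) (TTransform c)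
  TTransform-recurrence c c-rec m n = begin
      TTransform c (suc m) n
    ≡⟨ sumTo-cong n rearrange ⟩
      sumTo n (λ k → (A k - H k) + + a v m * (signedSt2! n k * C m k))
    ≡⟨ sumTo-+ n (λ k → A k - H k) (λ k → + a v m * (signedSt2! n k * C m k)) ⟩
      sumTo n (λ k → A k - H k) + sumTo n (λ k → + a v m * (signedSt2! n k * C m k))
    ≡⟨ cong₂ _+_ (sumTo-- n A H) (sumTo-* n (+ a v m) (λ k → signedSt2! n k * C m k)) ⟩
      (sumTo n A - sumTo n H) + + a v m * TTransform c m n
    ≡⟨ cong (λ t → sumTo n A - t + + a v m * TTransform c m n) (sumTo-shift n H H-zero H-top) ⟨
      (sumTo n A - sumTo n (λ k → H (suc k))) + + a v m * TTransform c m n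
    ≡⟨ cong (_+ + a v m * TTransform c m n) (sumTo-- n A (λ k → H (suc k))) ⟨
      sumTo n (λ k → A k - H (suc k)) + + a v m * TTransform c m n
    ≡⟨ cong (_+ + a v m * TTransform c m n) (sumTo-cong n expand) ⟨
      sumTo n (λ k → signedSt2! (suc n) (suc k) * C m (suc k)) + + a v m * TTransform c m n
    ≡⟨ cong (_+ + a v m * TTransform c m n) (sumTo-suc-head n (λ k → signedSt2! (suc n) k * C m k) first-zero) ⟨
      TTransform c m (suc n) + + a v m * TTransform c m n
    ∎
    where
    C : ℕ → ℕ → ℤ
    C m k = + c m k

    A H : ℕ → ℤ
    A k = signedSt2! n k * (+ suc k * C m (suc k))
    H k = + a v k * (signedSt2! n k * C m k)

    first-zero : signedSt2! (suc n) 0 * C m 0 ≡ + 0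
    first-zero = trans (cong (_* C m 0) (signedSt2!-suc-zero n)) (ℤP.*-zeroˡ (C m 0))

    H-zero : H 0 ≡ + 0
    H-zero = refl

    H-top : H (suc n) ≡ + 0
    H-top = trans (cong (λ t → + a v (suc n) * (t * C m (suc n))) (signedSt2!-above (ℕP.n<1+n n)))
                  (trans (cong (+ a v (suc n) *_) (ℤP.*-zeroˡ (C m (suc n)))) (ℤP.*-zeroʳ (+ a v (suc n))))

    expand : ∀ k → signedSt2! (suc n) (suc k) * C m (suc k) ≡ A k - H (suc k)
    expand k = trans (cong (_* C m (suc k)) (signedSt2!-suc n k))
                     (ring (+ suc k) (signedSt2! n k) (+ a v (suc k)) (signedSt2! n (suc k)) (C m (suc k)))
      where
      ring : ∀ K W α W′ X → (K * W - α * W′) * X ≡ W * (K * X) - α * (W′ * X)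
      ring = solve-∀

    rearrange : ∀ k → signedSt2! n k * C (suc m) k ≡ (A k - H k) + + a v m * (signedSt2! n k * C m k)
    rearrange k = begin
        W * C (suc m) k
      ≡⟨ ring₁ W (C (suc m) k) (+ a v k) (C m k) ⟩
        W * (C (suc m) k + + a v k * C m k) - + a v k * (W * C m k)
      ≡⟨ cong (λ t → W * t - + a v k * (W * C m k)) c-rec′ ⟩
        W * (+ suc k * C m (suc k) + + a v m * C m k) - + a v k * (W * C m k)
      ≡⟨ ring₂ W (+ suc k) (C m (suc k)) (+ a v m) (+ a v k) (C m k) ⟩
        (A k - H k) + + a v m * (W * C m k)
      ∎
      where
      W : ℤ
      W = signedSt2! n k

      c-rec′ : C (suc m) k + + a v k * C m k ≡ + suc k * C m (suc k) + + a v m * C m k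
      c-rec′ = begin
          C (suc m) k + + a v k * C m k                  ≡⟨ pos-+-* (c (suc m) k) (a v k) (c m k) ⟨
          + (c (suc m) k +ℕ a v k *ℕ c m k)              ≡⟨ cong +_ (c-rec m k) ⟩
          + (suc k *ℕ c m (suc k) +ℕ a v m *ℕ c m k)     ≡⟨ ℤP.pos-+ (suc k *ℕ c m (suc k)) (a v m *ℕ c m k) ⟩
          + (suc k *ℕ c m (suc k)) + + (a v m *ℕ c m k)  ≡⟨ cong₂ _+_ (ℤP.pos-* (suc k) (c m (suc k))) (ℤP.pos-* (a v m) (c m k)) ⟩
          + suc k * C m (suc k) + + a v m * C m k        ∎

      ring₁ : ∀ W X α Y → W * X ≡ W * (X + α * Y) - α * (W * Y)
      ring₁ = solve-∀

      ring₂ : ∀ W K X αm αk Y → W * (K * X + αm * Y) - αk * (W * Y) ≡ (W * (K * X) - αk * (W * Y)) + αm * (W * Y)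
      ring₂ = solve-∀

  kernel : ℕ → ℕ → ℕ
  kernel m k = m ! *ℕ (k +ℕ m +ℕ v ∸ 1) !

  kernel-recurrence-nonZero : ∀ m k → .{{NonZero (k +ℕ m +ℕ v)}} →
    kernel (suc m) k +ℕ a v k *ℕ kernel m k ≡ suc k *ℕ kernel m (suc k) +ℕ a v m *ℕ kernel m k
  kernel-recurrence-nonZero m k = begin
      suc m ! *ℕ (k +ℕ suc m +ℕ v ∸ 1) ! +ℕ a v k *ℕ kernel m k
    ≡⟨ cong (λ t → suc m ! *ℕ (t +ℕ v ∸ 1) ! +ℕ a v k *ℕ kernel m k) (ℕP.+-suc k m) ⟩
      suc m ! *ℕ N ! +ℕ a v k *ℕ (m ! *ℕ Y)
    ≡⟨ cong (λ t → suc m ! *ℕ t +ℕ a v k *ℕ (m ! *ℕ Y)) (!-pred N) ⟩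
      suc m ! *ℕ (N *ℕ Y) +ℕ a v k *ℕ (m ! *ℕ Y)
    ≡⟨ ring v m k (m !) Y ⟩
      suc k *ℕ (m ! *ℕ (N *ℕ Y)) +ℕ a v m *ℕ (m ! *ℕ Y)
    ≡⟨ cong (λ t → suc k *ℕ (m ! *ℕ t) +ℕ a v m *ℕ (m ! *ℕ Y)) (!-pred N) ⟨
      suc k *ℕ kernel m (suc k) +ℕ a v m *ℕ kernel m k
    ∎
    where
    N Y : ℕ
    N = k +ℕ m +ℕ v
    Y = (N ∸ 1) !

    ring : ∀ v m k X Y → suc m *ℕ X *ℕ ((k +ℕ m +ℕ v) *ℕ Y) +ℕ k *ℕ (k +ℕ v) *ℕ (X *ℕ Y)
                         ≡ suc k *ℕ (X *ℕ ((k +ℕ m +ℕ v) *ℕ Y)) +ℕ m *ℕ (m +ℕ v) *ℕ (X *ℕ Y)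
    ring = ℕRing.solve-∀

  -- k + m + v vanishes only for m = k = v = 0; there (k + m + v ∸ 1)! is a junk value,
  -- multiplied by a_m = a_k = 0.
  kernel-recurrence : KernelRecurrence kernel
  kernel-recurrence zero    zero    = cong (_+ℕ 0) (sym (ℕP.*-identityˡ (1 *ℕ v !)))
  kernel-recurrence m       (suc k) = kernel-recurrence-nonZero m (suc k)
  kernel-recurrence (suc m) zero    = kernel-recurrence-nonZero (suc m) zero

  factorial-*-rising : ∀ i → + (v !) * rising (+ v + + 1) i ≡ + ((i +ℕ v) !)
  factorial-*-rising zero    = ℤP.*-identityʳ (+ (v !))
  factorial-*-rising (suc i) = begin
      + (v !) * (rising (+ v + + 1) i * + (v +ℕ 1 +ℕ i))
    ≡⟨ ℤP.*-assoc (+ (v !)) (rising (+ v + + 1) i) (+ (v +ℕ 1 +ℕ i)) ⟨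
      + (v !) * rising (+ v + + 1) i * + (v +ℕ 1 +ℕ i)
    ≡⟨ cong (_* + (v +ℕ 1 +ℕ i)) (factorial-*-rising i) ⟩
      + ((i +ℕ v) !) * + (v +ℕ 1 +ℕ i)
    ≡⟨ ℤP.pos-* ((i +ℕ v) !) (v +ℕ 1 +ℕ i) ⟨
      + ((i +ℕ v) ! *ℕ (v +ℕ 1 +ℕ i))
    ≡⟨ cong +_ (ring ((i +ℕ v) !) v i) ⟩
      + ((suc i +ℕ v) !)
    ∎
    where
    ring : ∀ x v i → x *ℕ (v +ℕ 1 +ℕ i) ≡ suc (i +ℕ v) *ℕ x
    ring = ℕRing.solve-∀

  tTransform-base : ∀ n → + (v !) * tTransform (g v) 0 (suc n) ≡ TTransform kernel 0 (suc n)
  tTransform-base n = begin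
      + (v !) * (+ 1 * g v (suc n +ℕ 0))
    ≡⟨ cong (+ (v !) *_) (trans (ℤP.*-identityˡ (g v (suc n +ℕ 0))) (cong (g v) (ℕP.+-identityʳ (suc n)))) ⟩
      + (v !) * sum1 (suc n) h
    ≡⟨ cong (+ (v !) *_) (sum1≡sumTo (suc n) h h-zero) ⟩
      + (v !) * sumTo (suc n) h
    ≡⟨ sumTo-* (suc n) (+ (v !)) h ⟨
      sumTo (suc n) (λ j → + (v !) * h j)
    ≡⟨ sumTo-cong (suc n) pointwise ⟩
      TTransform kernel 0 (suc n)
    ∎
    where
    h : ℕ → ℤ
    h j = signedSt2! (suc n) j * rising (+ v + + 1) (j ∸ 1)

    h-zero : h 0 ≡ + 0
    h-zero = trans (cong (_* + 1) (signedSt2!-suc-zero n)) (ℤP.*-zeroˡ (+ 1))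

    pointwise : ∀ j → + (v !) * h j ≡ signedSt2! (suc n) j * + kernel 0 j
    pointwise zero = begin
        + (v !) * h 0                        ≡⟨ cong (+ (v !) *_) h-zero ⟩
        + (v !) * + 0                        ≡⟨ ℤP.*-zeroʳ (+ (v !)) ⟩
        + 0                                  ≡⟨ ℤP.*-zeroˡ (+ kernel 0 0) ⟨
        + 0 * + kernel 0 0                   ≡⟨ cong (_* + kernel 0 0) (signedSt2!-suc-zero n) ⟨
        signedSt2! (suc n) 0 * + kernel 0 0  ∎
    pointwise (suc i) = begin
        + (v !) * (signedSt2! (suc n) (suc i) * rising (+ v + + 1) i)
      ≡⟨ x∙yz≈y∙xz (+ (v !)) (signedSt2! (suc n) (suc i)) (rising (+ v + + 1) i) ⟩
        signedSt2! (suc n) (suc i) * (+ (v !) * rising (+ v + + 1) i)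
      ≡⟨ cong (signedSt2! (suc n) (suc i) *_) (factorial-*-rising i) ⟩
        signedSt2! (suc n) (suc i) * + ((i +ℕ v) !)
      ≡⟨ cong (λ t → signedSt2! (suc n) (suc i) * + t)
              (sym (trans (ℕP.*-identityˡ _) (cong (λ t → (t +ℕ v) !) (ℕP.+-identityʳ i)))) ⟩
        signedSt2! (suc n) (suc i) * + kernel 0 (suc i)
      ∎

  TTransform-kernel : ∀ m n → TTransform kernel m n
                              ≡ + (m !) * sumTo n (λ k → signedSt2! n k * + ((k +ℕ m +ℕ v ∸ 1) !))
  TTransform-kernel m n =
    trans (sumTo-cong n factor) (sumTo-* n (+ (m !)) (λ k → signedSt2! n k * + ((k +ℕ m +ℕ v ∸ 1) !)))
    where
    factor : ∀ k → signedSt2! n k * + kernel m k ≡ + (m !) * (signedSt2! n k * + ((k +ℕ m +ℕ v ∸ 1) !))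
    factor k = trans (cong (signedSt2! n k *_) (ℤP.pos-* (m !) ((k +ℕ m +ℕ v ∸ 1) !)))
                     (x∙yz≈y∙xz (signedSt2! n k) (+ (m !)) (+ ((k +ℕ m +ℕ v ∸ 1) !)))

proposition9 : (m v n : ℕ) → 1 ≤ n →
  (+ (v !)) * sumTo m (λ j → sgn (m +ℕ j) * st1 v m j * g v (n +ℕ j))
    ≡ (+ (m !)) * sumTo n (λ j → sgn (n +ℕ j) * (+ St2 v n j) * (+ (j !))
                                  * (+ ((j +ℕ m +ℕ v ∸ 1) !)))
proposition9 m v n 1≤n = trans v!t≡T (TTransform-kernel v m n)
  where
  v!t≡T : + (v !) * tTransform v (g v) m n ≡ TTransform v (kernel v) m n
  v!t≡T = recurrence-unique (λ m → + a v m)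
            (λ m n → + (v !) * tTransform v (g v) m n) (TTransform v (kernel v))
            (recurrence-scale (λ m → + a v m) (tTransform v (g v)) (+ (v !)) (tTransform-recurrence v (g v)))
            (TTransform-recurrence v (kernel v) (kernel-recurrence v))
            (tTransform-base v) m n 1≤n
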